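{- Let $n\ge 3$ and let $A\in CP_n$ have zero trace. (1) $\exp(A)=\exp(A:1)$. (2) If $j\in V_1$, then $\exp(A:1,j)=\exp(A:1,j-p)+p$, where $p=j-\max([1,j]\cap V_2)$ and $1\le p\le j-1$.
   Context: For $n \ge 2$, $C_n$ is the set of all $n\times n$ $(0,1)$-matrices $A=(a_{ij})$ with $a_{i,i+1}=1$ for $1\le i\le n-1$, last row arbitrary in $\{0,1\}^n$, and all other entries $0$. These are the $(0,1)$ companion matrices. A nonnegative matrix $A$ is primitive if $A^m$ has all entries positive for some positive integer $m$. The smallest such $m$ is the exponent $\exp(A)$. $CP_n$ is the set of primitive matrices in $C_n$. For a primitive $A$: - $\exp(A:i,j)$ is the smallest positive integer $k$ such that $(A^l)_{ij}>0$ for every integer $l\ge k$. Equivalently, it is the smallest $k$ such that the digraph $D(A)$ has a walk of length $l$ from $i$ to $j$ for every $l\ge k$. Here $D(A)$ has vertex set $\{1,\dots,n\}$ and an edge $(i,j)$ iff $a_{ij}=1$. - $\exp(A:i)$ is the smallest positive integer $q$ such that every entry of row $i$ of $A^q$ is positive. Also $V_1=\{i\in[1,n]: a_{ni}=0\}$ and $V_2=\{i\in[1,n]: a_{ni}>0\}$, where $[a,b]=\{i\in\mathbb Z: a\le i\le b\}$. -}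

module Defs where

open import Data.Nat using (ℕ; zero; suc; _+_; _*_; _∸_; _≤_; _<_; _≟_)
open import Data.Fin using (Fin; toℕ)
open import Data.Bool using (Bool; true; false)
open import Data.Product using (Σ; ∃; _×_)
open import Relation.Nullary using (yes; no)
open import Relation.Binary.PropositionalEquality using (_≡_)

-- n×n matrices over ℕ, indexed 0-based by Fin n (index i here is row/column i+1 of the paper)
Mat : ℕ → Set
Mat n = Fin n → Fin n → ℕ

sumFin : (n : ℕ) → (Fin n → ℕ) → ℕ
sumFin zero    f = 0
sumFin (suc n) f = f Fin.zero + sumFin n (λ i → f (Fin.suc i))


infixl 7 _⊗_
_⊗_ : {n : ℕ} → Mat n → Mat n → Mat n
_⊗_ {n} A B i j = sumFin n (λ k → A i k * B k j)

idMat : {n : ℕ} → Mat n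
idMat i j with toℕ i ≟ toℕ j
... | yes _ = 1
... | no  _ = 0

infixr 8 _^_
_^_ : {n : ℕ} → Mat n → ℕ → Mat n
A ^ zero  = idMat
A ^ suc k = A ⊗ (A ^ k)

trace : {n : ℕ} → Mat n → ℕ
trace {n} A = sumFin n (λ i → A i i)

b2n : Bool → ℕ
b2n true  = 1
b2n false = 0

companion : (m : ℕ) → (Fin (suc m) → Bool) → Mat (suc m)
companion m r i j with toℕ i ≟ m
... | yes _ = b2n (r j)
... | no  _ with toℕ j ≟ suc (toℕ i)
...   | yes _ = 1
...   | no  _ = 0

Positive : {n : ℕ} → Mat n → Set
Positive A = ∀ i j → 0 < A i j

Primitive : {n : ℕ} → Mat n → Set
Primitive A = ∃ λ k → 1 ≤ k × Positive (A ^ k)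

IsExp : {n : ℕ} → Mat n → ℕ → Set
IsExp A e = 1 ≤ e × Positive (A ^ e) × (∀ k → 1 ≤ k → Positive (A ^ k) → e ≤ k)

RowPositive : {n : ℕ} → Mat n → Fin n → Set
RowPositive A i = ∀ j → 0 < A i j

IsRowExp : {n : ℕ} → Mat n → Fin n → ℕ → Set
IsRowExp A i q = 1 ≤ q × RowPositive (A ^ q) i
               × (∀ k → 1 ≤ k → RowPositive (A ^ k) i → q ≤ k)

EventuallyPos : {n : ℕ} → Mat n → Fin n → Fin n → ℕ → Set
EventuallyPos A i j k = ∀ l → k ≤ l → 0 < (A ^ l) i j

IsEntryExp : {n : ℕ} → Mat n → Fin n → Fin n → ℕ → Set
IsEntryExp A i j k = 1 ≤ k × EventuallyPos A i j k
                   × (∀ k' → 1 ≤ k' → EventuallyPos A i j k' → k ≤ k')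

-- Read the companion matrix A with last row r as a digraph on the vertices 0,…,m
-- (vertex i is the paper's vertex i+1): a vertex i < m has the single out-edge
-- i → i+1, and the last vertex m has the edges m → k for every k with r k = true.
-- A positive entry (A^l) i j is the same thing as a walk of length l from i to j.
--
-- (1) Primitivity forces r 0 = true (something must enter vertex 0), so every
--     vertex has an in-edge and a positive row of A^q stays positive in A^(q+1).
--     As the only way out of a vertex i < m is to i+1, a positive row i of A^(q+1)
--     yields a positive row i+1 of A^q.  By induction a positive row 0 of A^q
--     makes A^q positive, whence exp(A) = exp(A:0).
-- (2) Let t be the last index ≤ j in the support of r.  The vertices t+1,…,j are
--     entered only from their predecessor, so the walks from 0 into j of length p+l
--     (p = j - t) are the walks into t of length l followed by t → … → j, and none
--     is shorter than p.  A general fact about least thresholds of eventually-true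
--     predicates on ℕ turns this into exp(A:0,j) = exp(A:0,t) + p; it needs that t
--     is not reached in both 0 and 1 steps, i.e. no loop at 0, which the zero trace
--     provides.
module Submission where

open import Defs
open import Data.Nat using (ℕ; zero; suc; _+_; _∸_; _≤_; _<_; _*_; z≤n; s≤s; _≟_; _≤?_)
open import Data.Nat.Properties
open import Data.Fin using (Fin; zero; suc; toℕ; inject₁; fromℕ)
open import Data.Fin.Properties using (toℕ-injective; toℕ-inject₁; toℕ-inject₁-≢; toℕ-fromℕ)
open import Data.Fin.Induction using (<-weakInduction)
open import Data.Bool using (Bool; true; false)
open import Data.Product using (Σ; ∃; _×_; _,_; proj₁; proj₂)
open import Data.Sum using (_⊎_; inj₁; inj₂)
open import Relation.Nullary using (¬_; yes; no; contradiction)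
open import Relation.Binary.PropositionalEquality using (_≡_; _≢_; refl; sym; trans; cong; subst)

sumFin-pos⇒term-pos : ∀ n (f : Fin n → ℕ) → 0 < sumFin n f → ∃ λ k → 0 < f k
sumFin-pos⇒term-pos (suc n) f pos with f zero in f0
... | suc _ = zero , subst (0 <_) (sym f0) (s≤s z≤n)
... | zero with sumFin-pos⇒term-pos n (λ i → f (suc i)) pos
...   | k , fk = suc k , fk

term-pos⇒sumFin-pos : ∀ n (f : Fin n → ℕ) k → 0 < f k → 0 < sumFin n f
term-pos⇒sumFin-pos (suc n) f zero    fk = ≤-trans fk (m≤m+n _ _)
term-pos⇒sumFin-pos (suc n) f (suc k) fk =
  ≤-trans (term-pos⇒sumFin-pos n (λ i → f (suc i)) k fk) (m≤n+m _ _)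

*-pos⇒factors-pos : ∀ a b → 0 < a * b → 0 < a × 0 < b
*-pos⇒factors-pos (suc a) (suc b) _ = s≤s z≤n , s≤s z≤n
*-pos⇒factors-pos (suc a) zero pos rewrite *-zeroʳ a = contradiction pos (<-irrefl refl)

factors-pos⇒*-pos : ∀ a b → 0 < a → 0 < b → 0 < a * b
factors-pos⇒*-pos (suc a) (suc b) _ _ = s≤s z≤n

module Walks {n : ℕ} (A : Mat n) where

  Edge : Fin n → Fin n → Set
  Edge i k = 0 < A i k

  infixr 5 _∷_
  data Walk : ℕ → Fin n → Fin n → Set where
    []  : ∀ {i} → Walk 0 i i
    _∷_ : ∀ {l i k j} → Edge i k → Walk l k j → Walk (suc l) i j

  power⇒walk : ∀ l i j → 0 < (A ^ l) i j → Walk l i j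
  power⇒walk zero i j pos with toℕ i ≟ toℕ j
  ... | yes i≡j with toℕ-injective {i = i} {j = j} i≡j
  ...   | refl = []
  power⇒walk zero i j () | no _
  power⇒walk (suc l) i j pos with sumFin-pos⇒term-pos n (λ k → A i k * (A ^ l) k j) pos
  ... | k , term with *-pos⇒factors-pos (A i k) ((A ^ l) k j) term
  ...   | edge , rest = edge ∷ power⇒walk l k j rest

  walk⇒power : ∀ {l i j} → Walk l i j → 0 < (A ^ l) i j
  walk⇒power {i = i} [] with toℕ i ≟ toℕ i
  ... | yes _ = s≤s z≤n
  ... | no i≢i = contradiction refl i≢i
  walk⇒power {suc l} {i} {j} (_∷_ {k = k} edge w) =
    term-pos⇒sumFin-pos n (λ k → A i k * (A ^ l) k j) k
      (factors-pos⇒*-pos _ _ edge (walk⇒power w))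

  snoc : ∀ {l i k j} → Walk l i k → Edge k j → Walk (suc l) i j
  snoc []       edge = edge ∷ []
  snoc (e ∷ w)  edge = e ∷ snoc w edge

  unsnoc : ∀ {l i j} → Walk (suc l) i j → ∃ λ k → Walk l i k × Edge k j
  unsnoc (edge ∷ []) = _ , [] , edge
  unsnoc (e ∷ w@(_ ∷ _)) with unsnoc w
  ... | k , w′ , edge = k , e ∷ w′ , edge

EventuallyFrom : (ℕ → Set) → ℕ → Set
EventuallyFrom P k = ∀ l → k ≤ l → P l

IsThreshold : (ℕ → Set) → ℕ → Set
IsThreshold P k =
  1 ≤ k × EventuallyFrom P k × (∀ k′ → 1 ≤ k′ → EventuallyFrom P k′ → k ≤ k′)

-- If P at p + l is equivalent to Q at l and P fails below p, the thresholds of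
-- P and Q differ by p, provided Q does not hold at both 0 and 1 (otherwise P
-- could have threshold p while the least positive threshold of Q is 1).
threshold-shift : ∀ {P Q : ℕ → Set} p
  → (∀ l → P (p + l) → Q l) → (∀ l → Q l → P (p + l))
  → (∀ l → l < p → ¬ P l) → ¬ (Q 0 × Q 1)
  → ∀ {a b} → IsThreshold P a → IsThreshold Q b → a ≡ b + p
threshold-shift {P} {Q} p P⇒Q Q⇒P short not01 {a} {b} (a≥1 , Pa , a-least) (b≥1 , Qb , b-least) =
  ≤-antisym a≤b+p b+p≤a
  where
    a≤b+p : a ≤ b + p
    a≤b+p = a-least (b + p) (≤-trans b≥1 (m≤m+n b p)) P-from-b+p
      where
        P-from-b+p : EventuallyFrom P (b + p)
        P-from-b+p l b+p≤l =
          subst P (m+[n∸m]≡n (m+n≤o⇒n≤o b b+p≤l))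
            (Q⇒P (l ∸ p) (Qb (l ∸ p) (m+n≤o⇒m≤o∸n b b+p≤l)))

    p≤a : p ≤ a
    p≤a with p ≤? a
    ... | yes p≤a = p≤a
    ... | no p≰a = contradiction (Pa a ≤-refl) (short a (≰⇒> p≰a))

    Q-from-a∸p : EventuallyFrom Q (a ∸ p)
    Q-from-a∸p l a∸p≤l =
      P⇒Q l (Pa (p + l) (subst (_≤ p + l) (m+[n∸m]≡n p≤a) (+-monoʳ-≤ p a∸p≤l)))

    a∸p≥1 : 1 ≤ a ∸ p
    a∸p≥1 with 1 ≤? a ∸ p
    ... | yes ok = ok
    ... | no a∸p≱1 =
      contradiction (Q-from-a∸p 0 (≤-reflexive a∸p≡0) , Q-from-a∸p 1 (subst (_≤ 1) (sym a∸p≡0) z≤n)) not01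
      where
        a∸p≡0 : a ∸ p ≡ 0
        a∸p≡0 = n<1⇒n≡0 (≰⇒> a∸p≱1)

    b+p≤a : b + p ≤ a
    b+p≤a = subst (b + p ≤_) (m∸n+n≡m p≤a) (+-monoˡ-≤ p (b-least (a ∸ p) a∸p≥1 Q-from-a∸p))

IsLastTrueUpTo : {m : ℕ} → (Fin (suc m) → Bool) → Fin (suc m) → Fin (suc m) → Set
IsLastTrueUpTo {m} r j t =
  toℕ t ≤ toℕ j × r t ≡ true
  × (∀ (s : Fin (suc m)) → toℕ s ≤ toℕ j → r s ≡ true → toℕ s ≤ toℕ t)

last-true-up-to : {m : ℕ} (r : Fin (suc m) → Bool) → r zero ≡ true
  → ∀ j → Σ (Fin (suc m)) (IsLastTrueUpTo r j)
last-true-up-to {m} r r0 = <-weakInduction (λ j → Σ (Fin (suc m)) (IsLastTrueUpTo r j)) at-zero step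
  where
    at-zero : Σ (Fin (suc m)) (IsLastTrueUpTo r zero)
    at-zero = zero , z≤n , r0 , λ s s≤0 _ → s≤0

    step : ∀ i → Σ (Fin (suc m)) (IsLastTrueUpTo r (inject₁ i))
      → Σ (Fin (suc m)) (IsLastTrueUpTo r (suc i))
    step i (t , t≤i , rt , t-last) with r (suc i) in r[1+i]
    ... | true  = suc i , ≤-refl , r[1+i] , λ _ s≤1+i _ → s≤1+i
    ... | false = t , ≤-trans (≤-trans t≤i (≤-reflexive (toℕ-inject₁ i))) (n≤1+n _) , rt , earlier
      where
        earlier : ∀ s → toℕ s ≤ suc (toℕ i) → r s ≡ true → toℕ s ≤ toℕ t
        earlier s s≤1+i rs with m≤n⇒m<n∨m≡n s≤1+i
        ... | inj₁ (s≤s s≤i) = t-last s (subst (toℕ s ≤_) (sym (toℕ-inject₁ i)) s≤i) rs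
        ... | inj₂ s≡1+i with toℕ-injective {i = s} {j = suc i} s≡1+i
        ...   | refl = contradiction (trans (sym rs) r[1+i]) λ ()

module Companion (m : ℕ) (r : Fin (suc m) → Bool) where

  A : Mat (suc m)
  A = companion m r

  open Walks A public

  b2n-pos : ∀ b → 0 < b2n b → b ≡ true
  b2n-pos true _ = refl

  edge-cases : ∀ i k → Edge i k
    → (toℕ i ≡ m × r k ≡ true) ⊎ (toℕ i ≢ m × toℕ k ≡ suc (toℕ i))
  edge-cases i k edge with toℕ i ≟ m
  ... | yes i≡m = inj₁ (i≡m , b2n-pos (r k) edge)
  ... | no i≢m with toℕ k ≟ suc (toℕ i)
  ...   | yes k≡1+i = inj₂ (i≢m , k≡1+i)
  edge-cases i k () | no _ | no _

  last-row-edge : ∀ i k → toℕ i ≡ m → r k ≡ true → Edge i k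
  last-row-edge i k i≡m rk with toℕ i ≟ m
  ... | yes _ rewrite rk = s≤s z≤n
  ... | no i≢m = contradiction i≡m i≢m

  superdiagonal-edge : ∀ i k → toℕ i ≢ m → toℕ k ≡ suc (toℕ i) → Edge i k
  superdiagonal-edge i k i≢m k≡1+i with toℕ i ≟ m
  ... | yes i≡m = contradiction i≡m i≢m
  ... | no _ with toℕ k ≟ suc (toℕ i)
  ...   | yes _ = s≤s z≤n
  ...   | no k≢1+i = contradiction k≡1+i k≢1+i

  inner : (v : Fin m) → toℕ (inject₁ v) ≢ m
  inner v eq = toℕ-inject₁-≢ v (sym eq)

  step-edge : (v : Fin m) → Edge (inject₁ v) (suc v)
  step-edge v = superdiagonal-edge (inject₁ v) (suc v) (inner v) (cong suc (sym (toℕ-inject₁ v)))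

  inner-out : (v : Fin m) → ∀ {k} → Edge (inject₁ v) k → k ≡ suc v
  inner-out v {k} edge with edge-cases (inject₁ v) k edge
  ... | inj₁ (i≡m , _) = contradiction i≡m (inner v)
  ... | inj₂ (_ , k≡1+i) = toℕ-injective (trans k≡1+i (cong suc (toℕ-inject₁ v)))

  inner-in : (v : Fin m) → r (suc v) ≡ false → ∀ {k} → Edge k (suc v) → k ≡ inject₁ v
  inner-in v r[1+v] {k} edge with edge-cases k (suc v) edge
  ... | inj₁ (_ , r[1+v]′) = contradiction (trans (sym r[1+v]′) r[1+v]) λ ()
  ... | inj₂ (_ , 1+v≡1+k) =
    toℕ-injective (trans (sym (suc-injective 1+v≡1+k)) (sym (toℕ-inject₁ v)))

  -- Primitivity forces r 0 = true: some walk ends in vertex 0, and only the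
  -- last vertex can enter it.
  primitive⇒r0 : Primitive A → r zero ≡ true
  primitive⇒r0 (suc k , _ , pos) with unsnoc (power⇒walk (suc k) zero zero (pos zero zero))
  ... | v , _ , edge with edge-cases v zero edge
  ... | inj₁ (_ , r0) = r0

  no-loop-at-zero : trace A ≡ 0 → ¬ Edge zero zero
  no-loop-at-zero tr loop = <-irrefl (sym (m+n≡0⇒m≡0 (A zero zero) tr)) loop

  -- Row i of A^q is positive: vertex i reaches every vertex in exactly q steps.
  RowWalks : ℕ → Fin (suc m) → Set
  RowWalks q i = ∀ j → Walk q i j

  -- With r 0 = true every vertex has an in-edge, so full rows persist.
  has-in-edge : r zero ≡ true → ∀ j → ∃ λ k → Edge k j
  has-in-edge r0 zero    = fromℕ m , last-row-edge (fromℕ m) zero (toℕ-fromℕ m) r0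
  has-in-edge r0 (suc v) = inject₁ v , step-edge v

  row-grow : r zero ≡ true → ∀ {q i} → RowWalks q i → RowWalks (suc q) i
  row-grow r0 row j with has-in-edge r0 j
  ... | k , edge = snoc (row k) edge

  row-shift : (v : Fin m) → ∀ {q} → RowWalks (suc q) (inject₁ v) → RowWalks q (suc v)
  row-shift v row j with row j
  ... | edge ∷ w with inner-out v edge
  ...   | refl = w

  all-rows : r zero ≡ true → ∀ {q} → RowWalks q zero → ∀ i → RowWalks q i
  all-rows r0 {q} row0 = <-weakInduction (RowWalks q) row0 (λ v row → row-shift v (row-grow r0 row))

  exp≡row-exp : Primitive A → ∀ e q → IsExp A e → IsRowExp A zero q → e ≡ q
  exp≡row-exp prim e q (e≥1 , Ae-pos , e-least) (q≥1 , Aq-row , q-least) = ≤-antisym e≤q q≤e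
    where
      e≤q : e ≤ q
      e≤q = e-least q q≥1 λ i j →
        walk⇒power (all-rows (primitive⇒r0 prim) (λ j′ → power⇒walk q zero j′ (Aq-row j′)) i j)
      q≤e : q ≤ e
      q≤e = q-least e e≥1 (Ae-pos zero)

  -- The stretch u → … → v is silent: no vertex strictly after u and up to v lies
  -- in the support of r, so each of them is entered only from its predecessor.
  Silent : Fin (suc m) → Fin (suc m) → Set
  Silent u v = ∀ w → toℕ u < toℕ w → toℕ w ≤ toℕ v → r w ≡ false

  silent-shrink : ∀ {u} (v : Fin m) → Silent u (suc v) → Silent u (inject₁ v)
  silent-shrink v silent w u<w w≤v =
    silent w u<w (≤-trans w≤v (≤-trans (≤-reflexive (toℕ-inject₁ v)) (n≤1+n _)))

  silent-end : ∀ d (u : Fin (suc m)) (v : Fin m) → suc (toℕ v) ≡ suc d + toℕ u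
    → Silent u (suc v) → r (suc v) ≡ false
  silent-end d u v 1+v≡1+d+u silent =
    silent (suc v) (≤-trans (s≤s (m≤n+m (toℕ u) d)) (≤-reflexive (sym 1+v≡1+d+u))) ≤-refl

  shorter-stretch : ∀ d (u : Fin (suc m)) (v : Fin m) → suc (toℕ v) ≡ suc d + toℕ u
    → toℕ (inject₁ v) ≡ d + toℕ u
  shorter-stretch d u v 1+v≡1+d+u = trans (toℕ-inject₁ v) (suc-injective 1+v≡1+d+u)

  stretch : ∀ d u v → toℕ v ≡ d + toℕ u → Silent u v
    → ∀ {i} l → (Walk (d + l) i v → Walk l i u) × (Walk l i u → Walk (d + l) i v)
  stretch zero u v v≡u _ l with toℕ-injective {i = v} {j = u} v≡u
  ... | refl = (λ w → w) , (λ w → w)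
  stretch (suc d) u (suc v) v≡d+u silent {i} l =
    (λ w → proj₁ inward (back w)) , (λ w → snoc (proj₂ inward w) (step-edge v))
    where
      inward : (Walk (d + l) i (inject₁ v) → Walk l i u) × (Walk l i u → Walk (d + l) i (inject₁ v))
      inward = stretch d u (inject₁ v) (shorter-stretch d u v v≡d+u) (silent-shrink v silent) l
      back : Walk (suc (d + l)) i (suc v) → Walk (d + l) i (inject₁ v)
      back w with unsnoc w
      ... | k , w′ , edge with inner-in v (silent-end d u v v≡d+u silent) {k} edge
      ...   | refl = w′

  no-short-walk : ∀ d u v → toℕ v ≡ d + toℕ u → Silent u v → ∀ l → l < d → ¬ Walk l zero v
  no-short-walk (suc d) u (suc v) _ _ zero _ ()
  no-short-walk (suc d) u (suc v) v≡d+u silent (suc l) (s≤s l<d) w with unsnoc w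
  ... | k , w′ , edge with inner-in v (silent-end d u v v≡d+u silent) {k} edge
  ...   | refl =
    no-short-walk d u (inject₁ v) (shorter-stretch d u v v≡d+u) (silent-shrink v silent) l l<d w′

  last-true-before : ∀ j t → r j ≡ false → IsLastTrueUpTo r j t → toℕ t < toℕ j
  last-true-before j t rj (t≤j , rt , _) = ≤∧≢⇒< t≤j t≢j
    where
      t≢j : toℕ t ≢ toℕ j
      t≢j t≡j with toℕ-injective {i = t} {j = j} t≡j
      ... | refl = contradiction (trans (sym rt) rj) λ ()

  entry-exp-shift : trace A ≡ 0 → ∀ j t → r j ≡ false → IsLastTrueUpTo r j t
    → ∀ a b → IsEntryExp A zero j a → IsEntryExp A zero t b → a ≡ b + (toℕ j ∸ toℕ t)
  entry-exp-shift tr j t rj (t≤j , _ , t-last) a b =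
    threshold-shift p
      (λ l pos → walk⇒power (proj₁ (stretch p t j j≡p+t silent l) (power⇒walk _ _ _ pos)))
      (λ l pos → walk⇒power (proj₂ (stretch p t j j≡p+t silent l) (power⇒walk _ _ _ pos)))
      (λ l l<p pos → no-short-walk p t j j≡p+t silent l l<p (power⇒walk _ _ _ pos))
      not-at-0-and-1
    where
      p : ℕ
      p = toℕ j ∸ toℕ t
      j≡p+t : toℕ j ≡ p + toℕ t
      j≡p+t = sym (m∸n+n≡m t≤j)
      silent : Silent t j
      silent w t<w w≤j with r w in rw
      ... | false = refl
      ... | true  = contradiction (t-last w w≤j rw) (<⇒≱ t<w)
      not-at-0-and-1 : ¬ (0 < (A ^ 0) zero t × 0 < (A ^ 1) zero t)
      not-at-0-and-1 (pos0 , pos1) with power⇒walk 0 zero t pos0 | power⇒walk 1 zero t pos1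
      ... | [] | loop ∷ [] = no-loop-at-zero tr loop

mainTheorem5 : (m : ℕ) → 2 ≤ m → (r : Fin (suc m) → Bool)
    → Primitive (companion m r) → trace (companion m r) ≡ 0
    → (∀ e q → IsExp (companion m r) e → IsRowExp (companion m r) Data.Fin.zero q → e ≡ q)
    × (∀ (j : Fin (suc m)) → r j ≡ false
    → Σ (Fin (suc m)) λ t →
    (toℕ t ≤ toℕ j × r t ≡ true
    × (∀ (s : Fin (suc m)) → toℕ s ≤ toℕ j → r s ≡ true → toℕ s ≤ toℕ t))
    × (1 ≤ toℕ j ∸ toℕ t × toℕ j ∸ toℕ t ≤ toℕ j)
    × (∀ a b → IsEntryExp (companion m r) Data.Fin.zero j a
    → IsEntryExp (companion m r) Data.Fin.zero t b
    → a ≡ b + (toℕ j ∸ toℕ t)))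
mainTheorem5 m _ r prim tr = exp≡row-exp prim , λ j rj →
  let (t , last) = last-true-up-to r (primitive⇒r0 prim) j
      t<j = last-true-before j t rj last
  in t , last , (m<n⇒0<n∸m t<j , m∸n≤m (toℕ j) (toℕ t)) , entry-exp-shift tr j t rj last
  where open Companion m r
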